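{- Let $\mathbb{V}=U\oplus W$ be a finite-dimensional vector space over a field $\mathcal{F}$, where $U$ and $W$ are nonzero subspaces and $\dim(\mathbb{V})>1$. Then the domination number of the direct sum graph $\Gamma_{U\oplus W}(\mathbb{V})$ is $1$.
   Context: Let $\mathbb{V}$ be a vector space over a field $\mathcal{F}$ with $\mathbb{V}=U\oplus W$, where $U,W$ are nonzero subspaces, $\dim U=r$, $\dim W=s$, $r+s=n=\dim\mathbb{V}$. Fix a basis $\{\alpha_1,\dots,\alpha_r\}$ of $U$ and a basis $\{\beta_1,\dots,\beta_s\}$ of $W$; every $x\in\mathbb{V}$ is written uniquely as $x=a_1\alpha_1+\dots+a_r\alpha_r+b_1\beta_1+\dots+b_s\beta_s$. The direct sum graph $\Gamma_{U\oplus W}(\mathbb{V})$ is the simple graph whose vertex set is $\{x=u+w: u\in U, w\in W, u\neq 0, w\neq 0\}$, in which two distinct vertices $x,y$ are adjacent iff there is an index $i$ such that the coefficient of $\alpha_i$ is nonzero in both $x$ and $y$, and there is an index $j$ such that the coefficient of $\beta_j$ is nonzero in both $x$ and $y$. A set $D$ of vertices is dominating if every vertex not in $D$ is adjacent to some vertex of $D$; the domination number is the minimum size of a dominating set. -}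

module Defs where

open import Level using (Level; _⊔_) renaming (suc to lsuc)
open import Algebra.Bundles using (CommutativeRing)
open import Data.Nat using (ℕ; _≤_)
open import Data.Fin using (Fin)
open import Data.Product using (Σ; ∃; _×_; _,_)
open import Data.List using (List; length)
open import Data.List.Relation.Unary.Any using (Any)
open import Data.List.Relation.Unary.AllPairs using (AllPairs)
open import Relation.Nullary using (¬_)
open import Relation.Binary.PropositionalEquality using (_≡_)

record Field c ℓ : Set (lsuc (c ⊔ ℓ)) where
  field
    commutativeRing : CommutativeRing c ℓ
  open CommutativeRing commutativeRing public
  field
    1≉0     : ¬ (1# ≈ 0#)
    inverse : ∀ x → ¬ (x ≈ 0#) → ∃ λ y → (x * y) ≈ 1#

module DirectSumGraph {c ℓ} (F : Field c ℓ) (r s : ℕ) where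
  open Field F

  -- An element x = a₁α₁+…+a_rα_r + b₁β₁+…+b_sβ_s of V = U ⊕ W, given by
  -- its (unique) coordinates with respect to the fixed bases of U and W.
  record Vec' : Set c where
    constructor ⟨_,_⟩
    field
      a : Fin r → Carrier
      b : Fin s → Carrier
  open Vec' public

  _≈V_ : Vec' → Vec' → Set ℓ
  x ≈V y = (∀ i → a x i ≈ a y i) × (∀ j → b x j ≈ b y j)

  record Vertex : Set (c ⊔ ℓ) where
    constructor vtx
    field
      vec  : Vec'
      u≢0  : ∃ λ i → ¬ (a vec i ≈ 0#)
      w≢0  : ∃ λ j → ¬ (b vec j ≈ 0#)
  open Vertex public

  _≈Γ_ : Vertex → Vertex → Set ℓ
  x ≈Γ y = vec x ≈V vec y

  Adj : Vertex → Vertex → Set ℓ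
  Adj x y = ¬ (x ≈Γ y)
          × (∃ λ i → ¬ (a (vec x) i ≈ 0#) × ¬ (a (vec y) i ≈ 0#))
          × (∃ λ j → ¬ (b (vec x) j ≈ 0#) × ¬ (b (vec y) j ≈ 0#))

  IsSet : List Vertex → Set (c ⊔ ℓ)
  IsSet D = AllPairs (λ x y → ¬ (x ≈Γ y)) D

  _∈Γ_ : Vertex → List Vertex → Set (c ⊔ ℓ)
  v ∈Γ D = Any (v ≈Γ_) D

  IsDominating : List Vertex → Set (c ⊔ ℓ)
  IsDominating D = ∀ v → ¬ (v ∈Γ D) → Any (Adj v) D

  DominationNumberIs : ℕ → Set (c ⊔ ℓ)
  DominationNumberIs k =
    (Σ (List Vertex) λ D → IsSet D × IsDominating D × length D ≡ k)
    × (∀ D → IsSet D → IsDominating D → k ≤ length D)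

-- The vector whose coordinates are all 1 has every α- and every β-coefficient
-- nonzero, so it is adjacent to every other vertex and dominates on its own;
-- and since the graph has a vertex, the empty set does not dominate.
module Submission where

open import Defs
open import Data.Nat using (ℕ; suc; _≤_; s≤s; z≤n)
open import Data.Fin using (zero)
open import Data.Product using (_,_)
open import Data.List using ([]; _∷_; [_]; length)
open import Data.List.Relation.Unary.Any using (here)
open import Data.List.Relation.Unary.All using ([])
open import Data.List.Relation.Unary.AllPairs using ([]; _∷_)
open import Relation.Nullary using (¬_)
open import Relation.Binary.PropositionalEquality using (refl)

module _ {c ℓ} (F : Field c ℓ) (r s : ℕ) where
  open DirectSumGraph F r s

  dominating-nonempty : Vertex → ∀ D → IsDominating D → 1 ≤ length D
  dominating-nonempty v []      dom with dom v (λ ())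
  ... | ()
  dominating-nonempty v (_ ∷ _) dom = s≤s z≤n

module _ {c ℓ} (F : Field c ℓ) (r s : ℕ) where
  open Field F using (1#; 1≉0)
  open DirectSumGraph F (suc r) (suc s)

  all-ones : Vertex
  all-ones = vtx ⟨ (λ _ → 1#) , (λ _ → 1#) ⟩ (zero , 1≉0) (zero , 1≉0)

  adjacent-all-ones : ∀ v → ¬ (v ≈Γ all-ones) → Adj v all-ones
  adjacent-all-ones v v≉1 with u≢0 v | w≢0 v
  ... | i , vᵢ≉0 | j , vⱼ≉0 = v≉1 , (i , vᵢ≉0 , 1≉0) , (j , vⱼ≉0 , 1≉0)

  all-ones-dominating : IsDominating [ all-ones ]
  all-ones-dominating v v∉ = here (adjacent-all-ones v (λ v≈1 → v∉ (here v≈1)))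

-- The dimension hypothesis is automatic once U and W are nonzero.
theorem2p3 : ∀ {c ℓ} (F : Field c ℓ) (r s : ℕ) → 2 Data.Nat.≤ suc r Data.Nat.+ suc s
    → DirectSumGraph.DominationNumberIs F (suc r) (suc s) 1
theorem2p3 F r s _ =
  ([ all-ones F r s ] , [] ∷ [] , all-ones-dominating F r s , refl) ,
  λ D _ → dominating-nonempty F (suc r) (suc s) (all-ones F r s) D
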